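{- Let $G$ be a finite, strongly connected, directed vertex-symmetric graph (multiple edges allowed) in which every vertex has in-degree and out-degree $d$. Fix a vertex $v$ and for each $k\ge 1$ let $n_k$ be the number of vertices at directed distance exactly $k$ from $v$ (by vertex symmetry this does not depend on $v$). Then $$\tau(G)\;\ge\;\theta(G):=\left\lceil \frac{\sum_{k} k\,n_k}{d}\right\rceil .$$
   Context: Transpose (universal exchange) model: every vertex holds one distinct packet destined for each other vertex; in one time step every directed edge can carry one packet (all edges may be used simultaneously). Formally, a communication graph (schedule) for transpose on $G$ is a choice, for every ordered pair $(u,w)$ of distinct vertices, of a directed path $T_{uw}$ from $u$ to $w$ in $G$ together with a labeling of the edges of $T_{uw}$ by positive integers (times) that strictly increase along the path, such that no edge of $G$ receives the same time twice over all the paths. $\tau(G)$ is the minimum, over all such communication graphs, of the largest time used. -}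

module Defs where

open import Data.Nat using (ℕ; zero; suc; _+_; _*_; _∸_; _≤_; _<_; NonZero)
open import Data.Nat.DivMod using (_/_)
open import Data.Fin using (Fin)
open import Data.Fin.Properties using (_≟_)
open import Data.Fin.Permutation using (Permutation′; _⟨$⟩ʳ_)
open import Data.Bool using (Bool; true; false; _∨_; _∧_; not)
open import Data.List using (List; []; _∷_; map; filter; length; allFin; upTo)
open import Data.Bool.ListAction using (any)
open import Data.Nat.ListAction using (sum)
open import Data.List.Relation.Unary.Unique.Propositional using (Unique)
open import Data.List.Relation.Unary.Linked using (Linked)
open import Data.List.Membership.Propositional using (_∈_)
open import Data.Product using (Σ; _×_; _,_; proj₁; proj₂; ∃)
open import Relation.Binary.PropositionalEquality using (_≡_; _≢_)
open import Relation.Nullary.Decidable using (⌊_⌋)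

record Digraph : Set where
  field
    n   : ℕ
    m   : ℕ
    src : Fin m → Fin n
    tgt : Fin m → Fin n

module _ (G : Digraph) where
  open Digraph G

  Vertex : Set
  Vertex = Fin n

  Edge : Set
  Edge = Fin m

  data Walk : Vertex → Vertex → List Edge → Set where
    nil  : ∀ {u} → Walk u u []
    cons : ∀ {u w e es} → src e ≡ u → Walk (tgt e) w es → Walk u w (e ∷ es)

  visited : Vertex → List Edge → List Vertex
  visited u es = u ∷ map tgt es

  Path : Vertex → Vertex → List Edge → Set
  Path u w es = Walk u w es × Unique (visited u es)

  StronglyConnected : Set
  StronglyConnected = ∀ (u w : Vertex) → ∃ λ es → Walk u w es

  outDeg inDeg : Vertex → ℕ
  outDeg v = length (filter (λ e → src e ≟ v) (allFin m))
  inDeg  v = length (filter (λ e → tgt e ≟ v) (allFin m))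

  Regular : ℕ → Set
  Regular d = ∀ (v : Vertex) → outDeg v ≡ d × inDeg v ≡ d

  IsAutomorphism : Permutation′ n → Permutation′ m → Set
  IsAutomorphism φ ψ = ∀ (e : Edge) →
    (src (ψ ⟨$⟩ʳ e) ≡ φ ⟨$⟩ʳ src e) × (tgt (ψ ⟨$⟩ʳ e) ≡ φ ⟨$⟩ʳ tgt e)

  VertexSymmetric : Set
  VertexSymmetric = ∀ (u w : Vertex) →
    Σ (Permutation′ n) λ φ → Σ (Permutation′ m) λ ψ →
      IsAutomorphism φ ψ × (φ ⟨$⟩ʳ u ≡ w)

  within : Vertex → ℕ → Vertex → Bool
  within v zero    w = ⌊ w ≟ v ⌋
  within v (suc k) w = within v k w ∨
    any (λ e → ⌊ tgt e ≟ w ⌋ ∧ within v k (src e)) (allFin m)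

  atDist : Vertex → ℕ → Vertex → Bool
  atDist v zero    w = within v zero w
  atDist v (suc k) w = within v (suc k) w ∧ not (within v k w)

  nAt : Vertex → ℕ → ℕ
  nAt v k = length (filter (λ w → atDist v k w Data.Bool.≟ true) (allFin n))

  -- Σ_{k ≥ 1} k n_k ; distances in a graph on n vertices are < n,
  -- so the sum over k = 1 … n covers all nonzero terms.
  distSum : Vertex → ℕ
  distSum v = sum (map (λ k → k * nAt v k) (upTo (suc n)))

  -- A communication graph (schedule) for transpose:
  -- for each ordered pair (u , w) a list of (edge , time) pairs.
  Schedule : Set
  Schedule = Vertex → Vertex → List (Edge × ℕ)

  ValidSchedule : Schedule → Set
  ValidSchedule S =
    (∀ (u w : Vertex) → u ≢ w →
       Path u w (map proj₁ (S u w))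
       × Linked _<_ (0 ∷ map proj₂ (S u w)))
    × (∀ (u w u′ w′ : Vertex) (e : Edge) (t : ℕ) → u ≢ w → u′ ≢ w′ →
         (e , t) ∈ S u w → (e , t) ∈ S u′ w′ → (u ≡ u′ × w ≡ w′))

  TimesBoundedBy : Schedule → ℕ → Set
  TimesBoundedBy S T = ∀ (u w : Vertex) (e : Edge) (t : ℕ) → u ≢ w →
    (e , t) ∈ S u w → t ≤ T

⌈_/_⌉ : (a d : ℕ) → .{{NonZero d}} → ℕ
⌈ a / d ⌉ = (a + (d ∸ 1)) / d

-- A packet from u to w crosses at least dist(u, w) edges, each at its own
-- (edge, time) slot, and no slot is shared by two packets.  With m = n d edges
-- and times 1 … T there are n d T slots, while the packets need
-- Σ_u Σ_w dist(u, w) of them, which is n · Σ_k k n_k by vertex symmetry.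
-- Hence Σ_k k n_k ≤ d T.

module Submission where

open import Defs
open import Data.Nat using (ℕ; _≤_; NonZero)
open import Data.Fin using (Fin)

open import Data.Nat.Properties hiding (_≟_; suc-injective)
open import Algebra.Properties.Semiring.Sum +-*-semiring
  using (sum-syntax; ∑-comm; ∑-permute; *-distribˡ-sum; sum-cong-≗)
open import Data.Bool.Base using (Bool; true; false; T; not; _∧_)
open import Data.Bool.Properties using (T-∧; T-∨; T-not-≡)
import Data.Bool.Properties as Bool
open import Data.Empty using (⊥-elim)
open import Data.Fin.Base using (zero; suc; toℕ)
open import Data.Fin.Permutation using (Permutation′; _⟨$⟩ʳ_; _⟨$⟩ˡ_; flip; inverseˡ; inverseʳ)
open import Data.Fin.Properties using (_≟_; toℕ-injective; suc-injective; nonZeroIndex)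
open import Data.List.Base
  using (List; []; _∷_; map; filter; length; concat; concatMap; tabulate; allFin; applyUpTo; upTo; cartesianProduct)
open import Data.List.Membership.Propositional using (_∈_; _─_; lose)
open import Data.List.Membership.Propositional.Properties
  using (∈-allFin; ∈-applyUpTo⁺; ∈-cartesianProduct⁺; ∈-concatMap⁻; ∈-map⁺)
open import Data.List.Properties
  using (length-++; length-map; length-removeAt′; map-∘; map-cong; length-applyUpTo; length-tabulate)
import Data.List.Relation.Unary.All as All
import Data.List.Relation.Unary.All.Properties as All
open import Data.List.Relation.Unary.AllPairs as AllPairs using (AllPairs; []; _∷_)
import Data.List.Relation.Unary.AllPairs.Properties as AllPairs
open import Data.List.Relation.Unary.Any using (here; there; satisfied)
open import Data.List.Relation.Unary.Any.Properties using (any⁺; any⁻)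
open import Data.List.Relation.Binary.Subset.Propositional using (_⊆_)
open import Data.List.Relation.Unary.Linked.Properties using (Linked⇒AllPairs)
open import Data.List.Relation.Unary.Unique.Propositional using (Unique)
open import Data.List.Relation.Unary.Unique.Propositional.Properties using (concat⁺; allFin⁺)
open import Data.Nat.Base using (zero; suc; _+_; _*_; _<_; z≤n; s≤s; s≤s⁻¹; _≤′_; ≤′-refl; ≤′-step)
open import Data.Nat.DivMod using (m<n*o⇒m/o<n)
open import Data.Nat.ListAction using (sum)
open import Data.Product using (_×_; _,_; proj₁; proj₂)
open import Data.Sum using (inj₁; inj₂)
open import Function using (_∘_; Equivalence)
open import Relation.Binary.PropositionalEquality
  using (_≡_; _≢_; refl; sym; trans; cong; cong₂; subst; subst₂; module ≡-Reasoning)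
open import Relation.Nullary using (does; yes; no; contradiction)
open import Relation.Nullary.Decidable using (toWitness; fromWitness)
open import Relation.Unary using (Pred; Decidable)

𝟙 : Bool → ℕ
𝟙 true  = 1
𝟙 false = 0

does-≟-true : (b : Bool) → does (b Bool.≟ true) ≡ b
does-≟-true true  = refl
does-≟-true false = refl

T⇔T⇒≡ : ∀ {a b} → (T a → T b) → (T b → T a) → a ≡ b
T⇔T⇒≡ {true}  {true}  _   _   = refl
T⇔T⇒≡ {true}  {false} a⇒b _   = ⊥-elim (a⇒b _)
T⇔T⇒≡ {false} {true}  _   b⇒a = ⊥-elim (b⇒a _)
T⇔T⇒≡ {false} {false} _   _   = refl

module _ {A : Set} where

  length-filter≡sum : ∀ {p} {P : Pred A p} (P? : Decidable P) xs →
                      length (filter P? xs) ≡ sum (map (𝟙 ∘ does ∘ P?) xs)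
  length-filter≡sum P? []       = refl
  length-filter≡sum P? (x ∷ xs) with does (P? x)
  ... | true  = cong suc (length-filter≡sum P? xs)
  ... | false = length-filter≡sum P? xs

  length-concat : (xss : List (List A)) → length (concat xss) ≡ sum (map length xss)
  length-concat []         = refl
  length-concat (xs ∷ xss) = trans (length-++ xs) (cong (length xs +_) (length-concat xss))

  ∈-─ : ∀ {x z : A} {ys} (x∈ys : x ∈ ys) → z ∈ ys → z ≢ x → z ∈ ys ─ x∈ys
  ∈-─ (here refl) (here refl) z≢x = contradiction refl z≢x
  ∈-─ (here refl) (there z∈) _    = z∈
  ∈-─ (there x∈)  (here refl) _   = here refl
  ∈-─ (there x∈)  (there z∈) z≢x  = there (∈-─ x∈ z∈ z≢x)

  Unique-⊆⇒length≤ : ∀ {xs ys : List A} → Unique xs → xs ⊆ ys → length xs ≤ length ys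
  Unique-⊆⇒length≤ {[]}          _            _     = z≤n
  Unique-⊆⇒length≤ {x ∷ xs} {ys} (x∉xs ∷ xs!) xs⊆ys = begin
    suc (length xs)           ≤⟨ s≤s (Unique-⊆⇒length≤ xs! xs⊆ys─x) ⟩
    suc (length (ys ─ x∈ys))  ≡⟨ length-removeAt′ ys _ ⟨
    length ys                 ∎
    where
    open ≤-Reasoning
    x∈ys = xs⊆ys (here refl)
    xs⊆ys─x : xs ⊆ ys ─ x∈ys
    xs⊆ys─x z∈xs = ∈-─ x∈ys (xs⊆ys (there z∈xs)) (λ z≡x → All.lookup x∉xs z∈xs (sym z≡x))

module _ {A B : Set} where

  length-concatMap : (F : A → List B) (xs : List A) →
                     length (concatMap F xs) ≡ sum (map (length ∘ F) xs)
  length-concatMap F xs = trans (length-concat (map F xs)) (cong sum (sym (map-∘ xs)))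

  length-cartesianProduct : (xs : List A) (ys : List B) →
                            length (cartesianProduct xs ys) ≡ length xs * length ys
  length-cartesianProduct []       ys = refl
  length-cartesianProduct (x ∷ xs) ys = trans (length-++ (map (x ,_) ys))
    (cong₂ _+_ (length-map (x ,_) ys) (length-cartesianProduct xs ys))

  Unique-concatMap : {F : A → List B} {xs : List A} → Unique xs → (∀ x → Unique (F x)) →
                     (∀ {x y z} → z ∈ F x → z ∈ F y → x ≡ y) → Unique (concatMap F xs)
  Unique-concatMap {xs = xs} xs! F! F-disjoint = concat⁺
    (All.map⁺ (All.universal F! xs))
    (AllPairs.map⁺ (AllPairs.map (λ x≢y {_} (z∈Fx , z∈Fy) → x≢y (F-disjoint z∈Fx z∈Fy)) xs!))

∈-applyUpTo-suc : ∀ {t n} → 0 < t → t ≤ n → t ∈ applyUpTo suc n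
∈-applyUpTo-suc {suc t} _ t<n = ∈-applyUpTo⁺ suc t<n

∑-mono-≤ : ∀ {n} {f g : Fin n → ℕ} → (∀ i → f i ≤ g i) → ∑[ i < n ] f i ≤ ∑[ i < n ] g i
∑-mono-≤ {zero}  f≤g = z≤n
∑-mono-≤ {suc n} f≤g = +-mono-≤ (f≤g zero) (∑-mono-≤ (f≤g ∘ suc))

∑-const : ∀ n c → ∑[ i < n ] c ≡ n * c
∑-const zero    c = refl
∑-const (suc n) c = cong (c +_) (∑-const n c)

∑-𝟙-≟ : ∀ {n} (x : Fin n) → ∑[ i < n ] 𝟙 (does (x ≟ i)) ≡ 1
∑-𝟙-≟ {suc n} zero    = cong suc (trans (∑-const n 0) (*-zeroʳ n))
∑-𝟙-≟ {suc n} (suc x) = ∑-𝟙-≟ x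

∑-single-≤ : ∀ {n B} (f : Fin n → ℕ) (b : Fin n → Bool) →
             (∀ {i j} → T (b i) → T (b j) → i ≡ j) → (∀ {i} → T (b i) → f i ≤ B) →
             ∑[ i < n ] (f i * 𝟙 (b i)) ≤ B
∑-single-≤ {zero}      f b _        _   = z≤n
∑-single-≤ {suc n} {B} f b b-unique f≤B with b zero in b₀
... | true  = begin
  f zero * 1 + rest  ≡⟨ cong₂ _+_ (*-identityʳ (f zero)) (n≤0⇒n≡0 rest≤0) ⟩
  f zero + 0         ≡⟨ +-identityʳ (f zero) ⟩
  f zero             ≤⟨ f≤B b-zero ⟩
  B                  ∎
  where
  open ≤-Reasoning
  rest = ∑[ i < n ] (f (suc i) * 𝟙 (b (suc i)))
  b-zero : T (b zero)
  b-zero = subst T (sym b₀) _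
  rest≤0 : rest ≤ 0
  rest≤0 = ∑-single-≤ (f ∘ suc) (b ∘ suc) (λ p q → suc-injective (b-unique p q))
                       (λ p → contradiction (b-unique b-zero p) λ ())
... | false = subst (_≤ B) (cong (_+ ∑[ i < n ] (f (suc i) * 𝟙 (b (suc i)))) (sym (*-zeroʳ (f zero))))
  (∑-single-≤ (f ∘ suc) (b ∘ suc) (λ p q → suc-injective (b-unique p q)) f≤B)

module _ {A : Set} where

  sum-map-tabulate : ∀ {n} (f : A → ℕ) (g : Fin n → A) →
                     sum (map f (tabulate g)) ≡ ∑[ i < n ] f (g i)
  sum-map-tabulate {zero}  f g = refl
  sum-map-tabulate {suc n} f g = cong (f (g zero) +_) (sum-map-tabulate f (g ∘ suc))

  sum-map-applyUpTo : ∀ (f : A → ℕ) (g : ℕ → A) n →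
                      sum (map f (applyUpTo g n)) ≡ ∑[ i < n ] f (g (toℕ i))
  sum-map-applyUpTo f g zero    = refl
  sum-map-applyUpTo f g (suc n) = cong (f (g 0) +_) (sum-map-applyUpTo f (g ∘ suc) n)

length-concatMap-allFin : ∀ {A : Set} {n} (F : Fin n → List A) →
                          length (concatMap F (allFin n)) ≡ ∑[ i < n ] length (F i)
length-concatMap-allFin {n = n} F =
  trans (length-concatMap F (allFin n)) (sum-map-tabulate (length ∘ F) (λ i → i))

length-filter-allFin : ∀ {n p} {P : Pred (Fin n) p} (P? : Decidable P) →
                       length (filter P? (allFin n)) ≡ ∑[ i < n ] 𝟙 (does (P? i))
length-filter-allFin {n} P? =
  trans (length-filter≡sum P? (allFin n)) (sum-map-tabulate (𝟙 ∘ does ∘ P?) (λ i → i))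

⌈/⌉≤ : ∀ {a d T} .{{_ : NonZero d}} → a ≤ T * d → ⌈ a / d ⌉ ≤ T
⌈/⌉≤ {a} {suc d} {T} a≤Td = s≤s⁻¹ (m<n*o⇒m/o<n (begin-strict
  a + d              <⟨ +-mono-≤-< a≤Td (n<1+n d) ⟩
  T * suc d + suc d  ≡⟨ +-comm (T * suc d) (suc d) ⟩
  suc T * suc d      ∎))
  where open ≤-Reasoning

module _ (G : Digraph) where
  open Digraph G

  within-edge : ∀ {u k x y} e → src e ≡ x → tgt e ≡ y →
                T (within G u k x) → T (within G u (suc k) y)
  within-edge {u} {k} e refl tgt≡y reach = Equivalence.from T-∨
    (inj₂ (any⁺ _ (lose (∈-allFin e) (Equivalence.from T-∧ (fromWitness tgt≡y , reach)))))

  within-walk : ∀ {u k x w es} → Walk G x w es → T (within G u k x) → T (within G u (k + length es) w)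
  within-walk {u} {k} {w = w} nil reach = subst (λ l → T (within G u l w)) (sym (+-identityʳ k)) reach
  within-walk {u} {k} {w = w} (cons {e = e} {es = es} src≡x walk) reach =
    subst (λ l → T (within G u l w)) (sym (+-suc k (length es)))
      (within-walk {u} {suc k} walk (within-edge {u} {k} e src≡x refl reach))

  within-mono : ∀ {u j k w} → j ≤ k → T (within G u j w) → T (within G u k w)
  within-mono {u} {j} {w = w} j≤k = go (≤⇒≤′ j≤k)
    where
    go : ∀ {k} → j ≤′ k → T (within G u j w) → T (within G u k w)
    go ≤′-refl        reach = reach
    go (≤′-step j≤′k) reach = Equivalence.from T-∨ (inj₁ (go j≤′k reach))

  atDist-minimal : ∀ {u w} k → T (atDist G u k w) →
                   T (within G u k w) × (∀ {j} → T (within G u j w) → k ≤ j)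
  atDist-minimal zero    reach = reach , λ _ → z≤n
  atDist-minimal {u} {w} (suc k) at-k
    with reach , unreached ← Equivalence.to T-∧ at-k = reach , minimal
    where
    minimal : ∀ {j} → T (within G u j w) → suc k ≤ j
    minimal {j} reach-j with j ≤? k
    ... | yes j≤k = ⊥-elim (subst T (Equivalence.to T-not-≡ unreached) (within-mono j≤k reach-j))
    ... | no  j≰k = ≰⇒> j≰k

  atDist-unique : ∀ {u w} j k → T (atDist G u j w) → T (atDist G u k w) → j ≡ k
  atDist-unique j k at-j at-k =
    ≤-antisym (proj₂ (atDist-minimal j at-j) (proj₁ (atDist-minimal k at-k)))
              (proj₂ (atDist-minimal k at-k) (proj₁ (atDist-minimal j at-j)))

  nAt≡∑ : ∀ u k → nAt G u k ≡ ∑[ w < n ] 𝟙 (atDist G u k w)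
  nAt≡∑ u k = trans (length-filter-allFin (λ w → atDist G u k w Bool.≟ true))
                    (sum-cong-≗ {n} (λ w → cong 𝟙 (does-≟-true (atDist G u k w))))

  distSum-≤ : ∀ u (L : Fin n → ℕ) → (∀ w → T (within G u (L w) w)) →
              distSum G u ≤ ∑[ w < n ] L w
  distSum-≤ u L reach = begin
    distSum G u
      ≡⟨ sum-map-applyUpTo (λ k → k * nAt G u k) (λ k → k) (suc n) ⟩
    ∑[ k < suc n ] (toℕ k * nAt G u (toℕ k))
      ≡⟨ sum-cong-≗ {suc n} (λ k → trans (cong (toℕ k *_) (nAt≡∑ u (toℕ k)))
                                         (*-distribˡ-sum (toℕ k) (λ w → 𝟙 (atDist G u (toℕ k) w)))) ⟩
    ∑[ k < suc n ] ∑[ w < n ] (toℕ k * 𝟙 (atDist G u (toℕ k) w))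
      ≡⟨ ∑-comm {suc n} {n} (λ k w → toℕ k * 𝟙 (atDist G u (toℕ k) w)) ⟩
    ∑[ w < n ] ∑[ k < suc n ] (toℕ k * 𝟙 (atDist G u (toℕ k) w))
      ≤⟨ ∑-mono-≤ (λ w → ∑-single-≤ {suc n} toℕ (λ k → atDist G u (toℕ k) w)
           (λ {i} {j} p q → toℕ-injective (atDist-unique (toℕ i) (toℕ j) p q))
           (λ {k} p → proj₂ (atDist-minimal (toℕ k) p) (reach w))) ⟩
    ∑[ w < n ] L w
      ∎
    where open ≤-Reasoning

  IsAutomorphism-flip : ∀ {φ ψ} → IsAutomorphism G φ ψ → IsAutomorphism G (flip φ) (flip ψ)
  IsAutomorphism-flip {φ} {ψ} aut e = flipped (proj₁ ∘ aut) , flipped (proj₂ ∘ aut)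
    where
    flipped : {end : Fin m → Fin n} → (∀ e → end (ψ ⟨$⟩ʳ e) ≡ φ ⟨$⟩ʳ end e) →
              end (ψ ⟨$⟩ˡ e) ≡ φ ⟨$⟩ˡ end e
    flipped {end} commutes = begin
      end (ψ ⟨$⟩ˡ e)                  ≡⟨ inverseˡ φ ⟨
      φ ⟨$⟩ˡ (φ ⟨$⟩ʳ end (ψ ⟨$⟩ˡ e))  ≡⟨ cong (φ ⟨$⟩ˡ_) (commutes (ψ ⟨$⟩ˡ e)) ⟨
      φ ⟨$⟩ˡ end (ψ ⟨$⟩ʳ (ψ ⟨$⟩ˡ e))  ≡⟨ cong (λ e′ → φ ⟨$⟩ˡ end e′) (inverseʳ ψ) ⟩
      φ ⟨$⟩ˡ end e                    ∎
      where open ≡-Reasoning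

  within-aut⁺ : ∀ {φ ψ} → IsAutomorphism G φ ψ → ∀ {v} k {x} →
                T (within G v k x) → T (within G (φ ⟨$⟩ʳ v) k (φ ⟨$⟩ʳ x))
  within-aut⁺ {φ}       aut zero reach = fromWitness (cong (φ ⟨$⟩ʳ_) (toWitness reach))
  within-aut⁺ {φ} {ψ} aut {v} (suc k) {x} reach with Equivalence.to T-∨ reach
  ... | inj₁ reach-k = Equivalence.from T-∨ (inj₁ (within-aut⁺ {φ} {ψ} aut k reach-k))
  ... | inj₂ via-edge with e , into-x ← satisfied (any⁻ _ (allFin m) via-edge)
                      with tgt≡x , reach-src ← Equivalence.to T-∧ into-x =
    within-edge {φ ⟨$⟩ʳ v} {k} (ψ ⟨$⟩ʳ e)
      (proj₁ (aut e)) (trans (proj₂ (aut e)) (cong (φ ⟨$⟩ʳ_) (toWitness tgt≡x)))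
      (within-aut⁺ {φ} {ψ} aut k reach-src)

  module _ {φ : Permutation′ n} {ψ : Permutation′ m} (aut : IsAutomorphism G φ ψ) where

    within-aut : ∀ v k x → within G (φ ⟨$⟩ʳ v) k (φ ⟨$⟩ʳ x) ≡ within G v k x
    within-aut v k x = T⇔T⇒≡
      (λ reach → subst₂ (λ v′ x′ → T (within G v′ k x′)) (inverseˡ φ) (inverseˡ φ)
                   (within-aut⁺ {flip φ} {flip ψ} (IsAutomorphism-flip {φ} {ψ} aut) k reach))
      (within-aut⁺ {φ} {ψ} aut k)

    atDist-aut : ∀ v k x → atDist G (φ ⟨$⟩ʳ v) k (φ ⟨$⟩ʳ x) ≡ atDist G v k x
    atDist-aut v zero    x = within-aut v zero x
    atDist-aut v (suc k) x = cong₂ (λ a b → a ∧ not b) (within-aut v (suc k) x) (within-aut v k x)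

    distSum-aut : ∀ v → distSum G (φ ⟨$⟩ʳ v) ≡ distSum G v
    distSum-aut v = cong sum (map-cong (λ k → cong (k *_) (nAt-aut k)) (upTo (suc n)))
      where
      nAt-aut : ∀ k → nAt G (φ ⟨$⟩ʳ v) k ≡ nAt G v k
      nAt-aut k = begin
        nAt G (φ ⟨$⟩ʳ v) k
          ≡⟨ nAt≡∑ (φ ⟨$⟩ʳ v) k ⟩
        ∑[ w < n ] 𝟙 (atDist G (φ ⟨$⟩ʳ v) k w)
          ≡⟨ ∑-permute (λ w → 𝟙 (atDist G (φ ⟨$⟩ʳ v) k w)) φ ⟩
        ∑[ w < n ] 𝟙 (atDist G (φ ⟨$⟩ʳ v) k (φ ⟨$⟩ʳ w))
          ≡⟨ sum-cong-≗ {n} (cong 𝟙 ∘ atDist-aut v k) ⟩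
        ∑[ w < n ] 𝟙 (atDist G v k w)
          ≡⟨ nAt≡∑ v k ⟨
        nAt G v k
          ∎
        where open ≡-Reasoning

  ∑-outDeg : ∑[ v < n ] outDeg G v ≡ m
  ∑-outDeg = begin
    ∑[ v < n ] outDeg G v
      ≡⟨ sum-cong-≗ {n} (λ v → length-filter-allFin (λ e → src e ≟ v)) ⟩
    ∑[ v < n ] ∑[ e < m ] 𝟙 (does (src e ≟ v))
      ≡⟨ ∑-comm {n} {m} (λ v e → 𝟙 (does (src e ≟ v))) ⟩
    ∑[ e < m ] ∑[ v < n ] 𝟙 (does (src e ≟ v))
      ≡⟨ sum-cong-≗ {m} (∑-𝟙-≟ ∘ src) ⟩
    ∑[ e < m ] 1
      ≡⟨ ∑-const m 1 ⟩
    m * 1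
      ≡⟨ *-identityʳ m ⟩
    m ∎
    where open ≡-Reasoning

  regular⇒m≡n*d : ∀ {d} → Regular G d → m ≡ n * d
  regular⇒m≡n*d {d} regular = begin
    m                      ≡⟨ ∑-outDeg ⟨
    ∑[ v < n ] outDeg G v  ≡⟨ sum-cong-≗ {n} (proj₁ ∘ regular) ⟩
    ∑[ v < n ] d           ≡⟨ ∑-const n d ⟩
    n * d                  ∎
    where open ≡-Reasoning

  module _ {S : Schedule G} {τ : ℕ} (valid : ValidSchedule G S) (bounded : TimesBoundedBy G S τ) where

    times-increasing : ∀ {u w} → u ≢ w → AllPairs _<_ (0 ∷ map proj₂ (S u w))
    times-increasing {u} {w} u≢w = Linked⇒AllPairs <-trans (proj₂ (proj₁ valid u w u≢w))

    Unique-S : ∀ {u w} → u ≢ w → Unique (S u w)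
    Unique-S u≢w with _ ∷ increasing ← times-increasing u≢w =
      AllPairs.map (λ t<t′ t≡t′ → <⇒≢ t<t′ (cong proj₂ t≡t′)) (AllPairs.map⁻ increasing)

    times-positive : ∀ {u w e t} → u ≢ w → (e , t) ∈ S u w → 0 < t
    times-positive u≢w et∈S with all-positive ∷ _ ← times-increasing u≢w =
      All.lookup all-positive (∈-map⁺ proj₂ et∈S)

    -- ValidSchedule constrains S u w only for u ≢ w, so the diagonal is discarded.
    slots : Fin n → Fin n → List (Fin m × ℕ)
    slots u w with u ≟ w
    ... | yes _ = []
    ... | no  _ = S u w

    ∈-slots : ∀ {u w x} → x ∈ slots u w → u ≢ w × x ∈ S u w
    ∈-slots {u} {w} with u ≟ w
    ... | yes _   = λ ()
    ... | no  u≢w = u≢w ,_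

    Unique-slots : ∀ u w → Unique (slots u w)
    Unique-slots u w with u ≟ w
    ... | yes _   = []
    ... | no  u≢w = Unique-S u≢w

    within-slots : ∀ u w → T (within G u (length (slots u w)) w)
    within-slots u w with u ≟ w
    ... | yes refl = fromWitness refl
    ... | no  u≢w  = subst (λ l → T (within G u l w)) (length-map proj₁ (S u w))
                       (within-walk {u} {0} (proj₁ (proj₁ (proj₁ valid u w u≢w))) (fromWitness refl))

    slot-owner-unique : ∀ {u w u′ w′ x} → x ∈ slots u w → x ∈ slots u′ w′ → u ≡ u′ × w ≡ w′
    slot-owner-unique {u} {w} {u′} {w′} {e , t} x∈ x∈′
      with u≢w , x∈S ← ∈-slots x∈ | u′≢w′ , x∈S′ ← ∈-slots x∈′ =
        proj₂ valid u w u′ w′ e t u≢w u′≢w′ x∈S x∈S′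

    slotRange : List (Fin m × ℕ)
    slotRange = cartesianProduct (allFin m) (applyUpTo suc τ)

    slots⊆slotRange : ∀ {u w x} → x ∈ slots u w → x ∈ slotRange
    slots⊆slotRange {u} {w} {e , t} x∈ with u≢w , x∈S ← ∈-slots x∈ =
      ∈-cartesianProduct⁺ (∈-allFin e)
        (∈-applyUpTo-suc (times-positive u≢w x∈S) (bounded u w e t u≢w x∈S))

    allSlots : List (Fin m × ℕ)
    allSlots = concatMap (λ u → concatMap (slots u) (allFin n)) (allFin n)

    length-allSlots : length allSlots ≡ ∑[ u < n ] ∑[ w < n ] length (slots u w)
    length-allSlots = trans (length-concatMap-allFin (λ u → concatMap (slots u) (allFin n)))
                            (sum-cong-≗ {n} (length-concatMap-allFin ∘ slots))

    Unique-allSlots : Unique allSlots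
    Unique-allSlots = Unique-concatMap (allFin⁺ n)
      (λ u → Unique-concatMap (allFin⁺ n) (Unique-slots u)
               (λ {w} {w′} x∈ x∈′ → proj₂ (slot-owner-unique {u} {w} {u} {w′} x∈ x∈′)))
      (λ {u} {u′} x∈ x∈′ →
        let w  , x∈slots  = satisfied (∈-concatMap⁻ (slots u)  {allFin n} x∈)
            w′ , x∈slots′ = satisfied (∈-concatMap⁻ (slots u′) {allFin n} x∈′)
        in proj₁ (slot-owner-unique {u} {w} {u′} {w′} x∈slots x∈slots′))

    allSlots⊆slotRange : allSlots ⊆ slotRange
    allSlots⊆slotRange x∈ =
      let u , x∈row   = satisfied (∈-concatMap⁻ (λ u → concatMap (slots u) (allFin n)) {allFin n} x∈)
          w , x∈slots = satisfied (∈-concatMap⁻ (slots u) {allFin n} x∈row)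
      in slots⊆slotRange {u} {w} x∈slots

    ∑-length-slots≤ : ∑[ u < n ] ∑[ w < n ] length (slots u w) ≤ m * τ
    ∑-length-slots≤ = begin
      ∑[ u < n ] ∑[ w < n ] length (slots u w)
        ≡⟨ length-allSlots ⟨
      length allSlots
        ≤⟨ Unique-⊆⇒length≤ Unique-allSlots allSlots⊆slotRange ⟩
      length slotRange
        ≡⟨ length-cartesianProduct (allFin m) (applyUpTo suc τ) ⟩
      length (allFin m) * length (applyUpTo suc τ)
        ≡⟨ cong₂ _*_ (length-tabulate {n = m} (λ e → e)) (length-applyUpTo {A = ℕ} suc τ) ⟩
      m * τ ∎
      where open ≤-Reasoning

    n*distSum≤m*τ : VertexSymmetric G → ∀ v → n * distSum G v ≤ m * τ
    n*distSum≤m*τ symmetric v = begin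
      n * distSum G v
        ≡⟨ ∑-const n (distSum G v) ⟨
      ∑[ u < n ] distSum G v
        ≡⟨ sum-cong-≗ {n} distSum-constant ⟩
      ∑[ u < n ] distSum G u
        ≤⟨ ∑-mono-≤ (λ u → distSum-≤ u (length ∘ slots u) (within-slots u)) ⟩
      ∑[ u < n ] ∑[ w < n ] length (slots u w)
        ≤⟨ ∑-length-slots≤ ⟩
      m * τ ∎
      where
      open ≤-Reasoning
      distSum-constant : ∀ u → distSum G v ≡ distSum G u
      distSum-constant u with φ , ψ , aut , refl ← symmetric v u = sym (distSum-aut {φ} {ψ} aut v)

lemma1 : (G : Digraph) (d : ℕ) .{{_ : NonZero d}} →
    StronglyConnected G → VertexSymmetric G → Regular G d →
    (v : Fin (Digraph.n G)) (S : Schedule G) (T : ℕ) →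
    ValidSchedule G S → TimesBoundedBy G S T →
    ⌈ distSum G v / d ⌉ ≤ T
lemma1 G d _ symmetric regular v S T valid bounded = ⌈/⌉≤ (*-cancelˡ-≤ n (begin
  n * distSum G v  ≤⟨ n*distSum≤m*τ G valid bounded symmetric v ⟩
  m * T            ≡⟨ cong (_* T) (regular⇒m≡n*d G regular) ⟩
  n * d * T        ≡⟨ *-assoc n d T ⟩
  n * (d * T)      ≡⟨ cong (n *_) (*-comm d T) ⟩
  n * (T * d)      ∎))
  where
  open Digraph G
  open ≤-Reasoning
  instance
    _ : NonZero n
    _ = nonZeroIndex v
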